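{- Let $\Gamma$ be a connected trivalent graph and $G\le\mathrm{Aut}(\Gamma)$ act vertex-transitively, but not edge-transitively, on $\Gamma$, with infinite vertex stabilizers. Let $s\ge 2$ and let $(\alpha_0,\dots,\alpha_s)$ be an alternating $s$-arc. Then $\alpha_0\ne\alpha_s$, and $\alpha_0$ and $\alpha_s$ are not adjacent.
   Context: Graphs are simple. An $s$-arc is a tuple $(\alpha_0,\dots,\alpha_s)$ with each $\{\alpha_i,\alpha_{i+1}\}$ an edge and $\alpha_{i-1}\neq\alpha_{i+1}$ for $1\le i\le s-1$. Under the hypotheses, $G$ has exactly two orbits on edges and each vertex is incident with exactly one edge of one orbit (red) and two edges of the other (blue). An $s$-arc is alternating if consecutive edges have different colours. -}

module Defs where

open import Data.Nat using (ℕ; zero; suc; _<_)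
open import Data.Product using (Σ; ∃; _×_; _,_; proj₁)
open import Data.Sum using (_⊎_)
open import Data.List using (List)
open import Data.List.Relation.Unary.Any using (Any)
open import Data.Empty using (⊥)
open import Relation.Nullary using (¬_)
open import Relation.Binary.PropositionalEquality using (_≡_; _≢_)

record SimpleGraph : Set₁ where
  field
    V     : Set
    Adj   : V → V → Set
    sym   : ∀ {u v} → Adj u v → Adj v u
    irrefl : ∀ {v} → ¬ Adj v v

module _ (Γ : SimpleGraph) where
  open SimpleGraph Γ

  Trivalent : Set
  Trivalent = ∀ v → Σ V λ a → Σ V λ b → Σ V λ c →
    Adj v a × Adj v b × Adj v c × a ≢ b × a ≢ c × b ≢ c ×
    (∀ w → Adj v w → (w ≡ a) ⊎ (w ≡ b) ⊎ (w ≡ c))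

  data Walk : V → V → Set where
    here : ∀ {v} → Walk v v
    step : ∀ {u w v} → Adj u w → Walk w v → Walk u v

  Connected : Set
  Connected = ∀ u v → Walk u v

  record Aut : Set where
    field
      fun   : V → V
      inv   : V → V
      left  : ∀ v → inv (fun v) ≡ v
      right : ∀ v → fun (inv v) ≡ v
      pres  : ∀ {u v} → Adj u v → Adj (fun u) (fun v)
      refl' : ∀ {u v} → Adj (fun u) (fun v) → Adj u v
  open Aut public

  _≈ᴬ_ : Aut → Aut → Set
  g ≈ᴬ h = ∀ v → fun g v ≡ fun h v

  idAut : Aut
  idAut = record { fun = λ v → v ; inv = λ v → v ; left = λ _ → _≡_.refl
                 ; right = λ _ → _≡_.refl ; pres = λ e → e ; refl' = λ e → e }

  _∘ᴬ_ : Aut → Aut → Aut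
  g ∘ᴬ h = record
    { fun = λ v → fun g (fun h v)
    ; inv = λ v → inv h (inv g v)
    ; left = λ v → trans' (Relation.Binary.PropositionalEquality.cong (inv h) (left g (fun h v))) (left h v)
    ; right = λ v → trans' (Relation.Binary.PropositionalEquality.cong (fun g) (right h (inv g v))) (right g v)
    ; pres = λ e → pres g (pres h e)
    ; refl' = λ e → refl' h (refl' g e) }
    where
      open import Relation.Binary.PropositionalEquality using () renaming (trans to trans')

  _⁻¹ᴬ : Aut → Aut
  g ⁻¹ᴬ = record
    { fun = inv g ; inv = fun g ; left = right g ; right = left g
    ; pres = λ {u} {v} e → refl' g (subst2 Adj (sym' (right g u)) (sym' (right g v)) e)
    ; refl' = λ {u} {v} e → subst2 Adj (right g u) (right g v) (pres g e) }
    where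
      open import Relation.Binary.PropositionalEquality using (subst₂) renaming (sym to sym')
      subst2 = subst₂

  record Subgroup : Set₁ where
    field
      _∈G_   : Aut → Set
      ext    : ∀ {g h} → g ≈ᴬ h → _∈G_ g → _∈G_ h
      hasId  : _∈G_ idAut
      closed∘ : ∀ {g h} → _∈G_ g → _∈G_ h → _∈G_ (g ∘ᴬ h)
      closed⁻¹ : ∀ {g} → _∈G_ g → _∈G_ (g ⁻¹ᴬ)
  open Subgroup public

  module _ (G : Subgroup) where
    private
      mem = Subgroup._∈G_ G

    VertexTransitive : Set
    VertexTransitive = ∀ u v → Σ Aut λ g → mem g × fun g u ≡ v

    SameEdgeOrbit : V → V → V → V → Set
    SameEdgeOrbit a b c d = Σ Aut λ g → mem g ×
      ((fun g a ≡ c × fun g b ≡ d) ⊎ (fun g a ≡ d × fun g b ≡ c))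

    EdgeTransitive : Set
    EdgeTransitive = ∀ a b c d → Adj a b → Adj c d → SameEdgeOrbit a b c d

    Stab : V → Set
    Stab v = Σ Aut λ g → mem g × fun g v ≡ v

    FiniteStab : V → Set
    FiniteStab v = Σ (List (Stab v)) λ L →
      ∀ (x : Stab v) → Any (λ y → proj₁ x ≈ᴬ proj₁ y) L

    InfiniteStabilizers : Set
    InfiniteStabilizers = ∀ v → ¬ FiniteStab v

    -- α : ℕ → V, only α 0 … α s matter.
    IsArc : ℕ → (ℕ → V) → Set
    IsArc s α = (∀ i → i < s → Adj (α i) (α (suc i)))
              × (∀ i → suc i < s → α i ≢ α (suc (suc i)))

    IsAlternating : ℕ → (ℕ → V) → Set
    IsAlternating s α = ∀ i → suc i < s →
      ¬ SameEdgeOrbit (α i) (α (suc i)) (α (suc i)) (α (suc (suc i)))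

-- The edges α₀α₁ and α₁α₂ lie in different G-orbits, so one of the three edges at α₁ is alone in
-- its orbit; by vertex-transitivity that orbit is a G-invariant perfect matching (the red edges),
-- and every vertex has two blue edges.  If α₀ = αₛ or α₀αₛ is an edge, following the closed
-- alternating walk shows that the pointwise stabiliser of some red-first alternating path (a
-- chain) fixes the blue neighbours of its start.  A Tutte-type induction on the length then gives
-- an i for which this holds for every i-chain: while G is transitive on i-chains and some chain
-- stabiliser swaps two blue neighbours, G stays transitive on (i+1)-chains.  For that i, an
-- automorphism fixing one chain fixes a chain at each neighbouring vertex, hence is trivial by
-- connectivity; and fixing one more chain vertex has index at most 2, so vertex stabilisers are
-- finite.  The case distinctions are classical, which is harmless under double negation because
-- the conclusion is negative.

module Submission where

open import Defs
open import Data.Nat using (ℕ; zero; suc; _≤_; _<_; z≤n; s≤s; _∸_)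
open import Data.Nat.Properties using (≤-refl; ≤-trans; ≤-pred; n≤1+n; m∸n≤m; n∸n≡0)
open import Data.Nat.Induction using (<-rec)
open import Data.Product using (Σ; _×_; _,_; proj₁; proj₂)
open import Data.Sum using (_⊎_; inj₁; inj₂)
import Data.Sum as Sum
open import Data.Empty using (⊥; ⊥-elim)
open import Data.Unit using (⊤; tt)
open import Data.List using (List; []; _∷_; _++_; map)
open import Data.List.Relation.Unary.Any using (Any; here)
import Data.List.Relation.Unary.Any as Any
import Data.List.Relation.Unary.Any.Properties as Anyₚ
open import Level using (0ℓ)
open import Function.Bundles using (_⇔_; mk⇔; Equivalence)
open import Effect.Monad using (RawMonad)
open import Relation.Nullary using (¬_; Dec; yes; no)
open import Relation.Nullary.Negation using (¬¬-Monad)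
open import Relation.Nullary.Decidable using (¬¬-excluded-middle)
open import Relation.Binary.PropositionalEquality
  using (_≡_; _≢_; refl; sym; trans; cong; subst; module ≡-Reasoning)

open RawMonad (¬¬-Monad {0ℓ})

∸-suc : ∀ {s i} → i < s → s ∸ i ≡ suc (s ∸ suc i)
∸-suc {suc s} {zero}  _         = refl
∸-suc {suc s} {suc i} (s≤s i<s) = ∸-suc i<s

∸-suc-< : ∀ {s i} → i < s → s ∸ suc i < s
∸-suc-< {s} {i} i<s = subst (_≤ s) (∸-suc i<s) (m∸n≤m s i)

ExactlyOne : Set → Set → Set
ExactlyOne A B = (A ⊎ B) × ¬ (A × B)

exactlyOne-¬ʳ : ∀ {A B} → ExactlyOne A B → A → ¬ B
exactlyOne-¬ʳ (_ , notBoth) a b = notBoth (a , b)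

exactlyOne-ʳ : ∀ {A B} → ExactlyOne A B → ¬ A → B
exactlyOne-ʳ (inj₁ a , _) ¬a = ⊥-elim (¬a a)
exactlyOne-ʳ (inj₂ b , _) _  = b

exactlyOne-swap : ∀ {A B A′ B′} → A′ ⇔ A → B′ ⇔ B → ExactlyOne A B → ExactlyOne B′ A′
exactlyOne-swap A′⇔A B′⇔B (a⊎b , notBoth) =
  Sum.swap (Sum.map (from A′⇔A) (from B′⇔B) a⊎b) ,
  λ (b′ , a′) → notBoth (to A′⇔A a′ , to B′⇔B b′)
  where open Equivalence

module EdgeOrbits (Γ : SimpleGraph) (G : Subgroup Γ) where
  open SimpleGraph Γ using (V)

  SameOrbit : V → V → V → V → Set
  SameOrbit = SameEdgeOrbit Γ G

  infixr 9 _∘_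
  infix 10 _⁻¹

  _∘_ : Aut Γ → Aut Γ → Aut Γ
  _∘_ = _∘ᴬ_ Γ

  _⁻¹ : Aut Γ → Aut Γ
  _⁻¹ = _⁻¹ᴬ Γ

  fun⁻¹-≡ : (g : Aut Γ) {x y : V} → fun g x ≡ y → fun (g ⁻¹) y ≡ x
  fun⁻¹-≡ g {x} refl = left g x

  fun-injective : (g : Aut Γ) {x y : V} → fun g x ≡ fun g y → x ≡ y
  fun-injective g {x} {y} e = trans (sym (left g x)) (trans (cong (inv g) e) (left g y))

  sameOrbit-image : ∀ {g} → _∈G_ G g → ∀ x y → SameOrbit x y (fun g x) (fun g y)
  sameOrbit-image {g} g∈G x y = g , g∈G , inj₁ (refl , refl)

  sameOrbit-sym : ∀ {a b c d} → SameOrbit a b c d → SameOrbit c d a b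
  sameOrbit-sym (g , g∈G , inj₁ (e₁ , e₂)) =
    g ⁻¹ , closed⁻¹ G g∈G , inj₁ (fun⁻¹-≡ g e₁ , fun⁻¹-≡ g e₂)
  sameOrbit-sym (g , g∈G , inj₂ (e₁ , e₂)) =
    g ⁻¹ , closed⁻¹ G g∈G , inj₂ (fun⁻¹-≡ g e₂ , fun⁻¹-≡ g e₁)

  sameOrbit-swapˡ : ∀ {a b c d} → SameOrbit a b c d → SameOrbit b a c d
  sameOrbit-swapˡ (g , g∈G , inj₁ (e₁ , e₂)) = g , g∈G , inj₂ (e₂ , e₁)
  sameOrbit-swapˡ (g , g∈G , inj₂ (e₁ , e₂)) = g , g∈G , inj₁ (e₂ , e₁)

  sameOrbit-trans : ∀ {a b c d e f} → SameOrbit a b c d → SameOrbit c d e f → SameOrbit a b e f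
  sameOrbit-trans (g , g∈G , p) (h , h∈G , q) = h ∘ g , closed∘ G h∈G g∈G , compose p q
    where
      _⨾_ : ∀ {x y z} → fun g x ≡ y → fun h y ≡ z → fun h (fun g x) ≡ z
      e ⨾ e′ = trans (cong (fun h) e) e′
      compose : ∀ {a b c d e f} → (fun g a ≡ c × fun g b ≡ d) ⊎ (fun g a ≡ d × fun g b ≡ c) →
        (fun h c ≡ e × fun h d ≡ f) ⊎ (fun h c ≡ f × fun h d ≡ e) →
        (fun h (fun g a) ≡ e × fun h (fun g b) ≡ f) ⊎ (fun h (fun g a) ≡ f × fun h (fun g b) ≡ e)
      compose (inj₁ (e₁ , e₂)) (inj₁ (f₁ , f₂)) = inj₁ (e₁ ⨾ f₁ , e₂ ⨾ f₂)
      compose (inj₁ (e₁ , e₂)) (inj₂ (f₁ , f₂)) = inj₂ (e₁ ⨾ f₁ , e₂ ⨾ f₂)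
      compose (inj₂ (e₁ , e₂)) (inj₁ (f₁ , f₂)) = inj₂ (e₁ ⨾ f₂ , e₂ ⨾ f₁)
      compose (inj₂ (e₁ , e₂)) (inj₂ (f₁ , f₂)) = inj₁ (e₁ ⨾ f₂ , e₂ ⨾ f₁)

module Neighbourhoods (Γ : SimpleGraph) where
  open SimpleGraph Γ using (V; Adj)

  IsNeighbourhood : V → V → V → V → Set
  IsNeighbourhood v a b c = Adj v a × Adj v b × Adj v c × a ≢ b × a ≢ c × b ≢ c ×
    (∀ w → Adj v w → (w ≡ a) ⊎ (w ≡ b) ⊎ (w ≡ c))

  neighbourhood-adj₁ : ∀ {v a b c} → IsNeighbourhood v a b c → Adj v a
  neighbourhood-adj₁ (pa , _) = pa

  neighbourhood-only : ∀ {v a b c} → IsNeighbourhood v a b c →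
    ∀ w → Adj v w → (w ≡ a) ⊎ (w ≡ b) ⊎ (w ≡ c)
  neighbourhood-only (_ , _ , _ , _ , _ , _ , only) = only

  neighbourhood-swap₁₂ : ∀ {v a b c} → IsNeighbourhood v a b c → IsNeighbourhood v b a c
  neighbourhood-swap₁₂ (pa , pb , pc , a≢b , a≢c , b≢c , only) =
    pb , pa , pc , (λ e → a≢b (sym e)) , b≢c , a≢c ,
    λ w p → Sum.assocʳ (Sum.map₁ Sum.swap (Sum.assocˡ (only w p)))

  neighbourhood-swap₂₃ : ∀ {v a b c} → IsNeighbourhood v a b c → IsNeighbourhood v a c b
  neighbourhood-swap₂₃ (pa , pb , pc , a≢b , a≢c , b≢c , only) =
    pa , pc , pb , a≢c , a≢b , (λ e → b≢c (sym e)) , λ w p → Sum.map₂ Sum.swap (only w p)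

  neighbourhood-startingAt : ∀ {v a b c r} → IsNeighbourhood v a b c → Adj v r →
    Σ V λ y → Σ V λ z → IsNeighbourhood v r y z
  neighbourhood-startingAt {a = a} {b} {c} n@(_ , _ , _ , _ , _ , _ , only) p with only _ p
  ... | inj₁ refl = b , c , n
  ... | inj₂ (inj₁ refl) = a , c , neighbourhood-swap₁₂ n
  ... | inj₂ (inj₂ refl) = a , b , neighbourhood-swap₁₂ (neighbourhood-swap₂₃ n)

  neighbourhood-through : ∀ {v r y z w} → IsNeighbourhood v r y z → Adj v w → w ≢ r →
    Σ V λ w′ → IsNeighbourhood v r w w′
  neighbourhood-through {z = z} n@(_ , _ , _ , _ , _ , _ , only) p w≢r with only _ p
  ... | inj₁ refl = ⊥-elim (w≢r refl)
  ... | inj₂ (inj₁ refl) = z , n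
  ... | inj₂ (inj₂ refl) = _ , neighbourhood-swap₂₃ n

  completeNeighbourhood : Trivalent Γ → ∀ {v r w} → Adj v r → Adj v w → w ≢ r →
    Σ V λ w′ → IsNeighbourhood v r w w′
  completeNeighbourhood tri {v} r-adj w-adj w≢r =
    let (_ , _ , _ , nbhd) = tri v
        (_ , _ , nbhd′) = neighbourhood-startingAt nbhd r-adj
    in neighbourhood-through nbhd′ w-adj w≢r

record RedMatching (Γ : SimpleGraph) (G : Subgroup Γ) : Set where
  open SimpleGraph Γ using (V; Adj)
  field
    red             : V → V
    red-adj         : ∀ v → Adj v (red v)
    red-involutive  : ∀ v → red (red v) ≡ v
    red-equivariant : ∀ {g} → _∈G_ G g → ∀ v → fun g (red v) ≡ red (fun g v)

module Colouring (Γ : SimpleGraph) (G : Subgroup Γ) (tri : Trivalent Γ) (vt : VertexTransitive Γ G)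
  (M : RedMatching Γ G) where
  open SimpleGraph Γ using (V; Adj; irrefl) renaming (sym to adj-sym)
  open EdgeOrbits Γ G
  open Neighbourhoods Γ
  open RedMatching M

  _∈G : Aut Γ → Set
  g ∈G = _∈G_ G g

  red-fixed : ∀ {g} → g ∈G → ∀ {u} → fun g u ≡ u → fun g (red u) ≡ red u
  red-fixed g∈G {u} e = trans (red-equivariant g∈G u) (cong red e)

  red-fixed′ : ∀ {g} → g ∈G → ∀ {u w} → fun g u ≡ u → w ≡ red u → fun g w ≡ w
  red-fixed′ g∈G gu refl = red-fixed g∈G gu

  red-swap : ∀ {u w} → w ≡ red u → u ≡ red w
  red-swap {u} e = trans (sym (red-involutive u)) (cong red (sym e))

  Blue : V → V → Set
  Blue u w = Adj u w × w ≢ red u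

  blueNeighbourhood : ∀ u → Σ V λ y → Σ V λ z → IsNeighbourhood u (red u) y z
  blueNeighbourhood u = let (_ , _ , _ , nbhd) = tri u in neighbourhood-startingAt nbhd (red-adj u)

  red-or-blue : ∀ {u w} → Adj u w → (w ≡ red u) ⊎ Blue u w
  red-or-blue {u} p with blueNeighbourhood u
  ... | _ , _ , (_ , _ , _ , r≢y , r≢z , _ , only) with only _ p
  ...   | inj₁ e = inj₁ e
  ...   | inj₂ (inj₁ refl) = inj₂ (p , λ e → r≢y (sym e))
  ...   | inj₂ (inj₂ refl) = inj₂ (p , λ e → r≢z (sym e))

  some-blue : ∀ u → Σ V λ w → Blue u w
  some-blue u with blueNeighbourhood u
  ... | y , _ , (_ , py , _ , r≢y , _) = y , py , λ e → r≢y (sym e)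

  blue-other : ∀ {u w} → Blue u w →
    Σ V λ w′ → Blue u w′ × w ≢ w′ × (∀ z → Blue u z → (z ≡ w) ⊎ (z ≡ w′))
  blue-other {u} (p , w≢r) with blueNeighbourhood u
  ... | _ , _ , nbhd with neighbourhood-through nbhd p w≢r
  ...   | w′ , (_ , _ , p′ , _ , r≢w′ , w≢w′ , only) =
    w′ , (p′ , λ e → r≢w′ (sym e)) , w≢w′ , λ z (q , z≢r) → notRed z≢r (only z q)
    where
      notRed : ∀ {z} → z ≢ red u → (z ≡ red u) ⊎ (z ≡ _) ⊎ (z ≡ w′) →
        (z ≡ _) ⊎ (z ≡ w′)
      notRed z≢r (inj₁ e) = ⊥-elim (z≢r e)
      notRed z≢r (inj₂ e) = e

  blue-dec : ∀ {u x y} → Blue u x → Blue u y → Dec (x ≡ y)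
  blue-dec bx by with blue-other bx
  ... | _ , _ , x≢x′ , only with only _ by
  ...   | inj₁ refl = yes refl
  ...   | inj₂ refl = no x≢x′

  blue-sym : ∀ {u w} → Blue u w → Blue w u
  blue-sym (p , w≢r) = adj-sym p , λ e → w≢r (red-swap e)

  blue-map : ∀ {g} → g ∈G → ∀ {u w} → Blue u w → Blue (fun g u) (fun g w)
  blue-map {g} g∈G {u} (p , w≢r) =
    pres g p , λ e → w≢r (fun-injective g (trans e (sym (red-equivariant g∈G u))))

  blue-map-fixed : ∀ {g} → g ∈G → ∀ {p w} → fun g p ≡ p → Blue p w → Blue p (fun g w)
  blue-map-fixed {g} g∈G {w = w} e bw = subst (λ x → Blue x (fun g w)) e (blue-map g∈G bw)

  fixes-blue : ∀ {g} → g ∈G → ∀ {p x} → fun g p ≡ p → Blue p x → fun g x ≡ x →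
    ∀ z → Blue p z → fun g z ≡ z
  fixes-blue {g} g∈G gp bx gx z bz with blue-other bx
  ... | x′ , bx′ , x≢x′ , only with only z bz | only (fun g x′) (blue-map-fixed g∈G gp bx′)
  ...   | inj₁ refl | _ = gx
  ...   | inj₂ refl | inj₁ gx′≡x  = ⊥-elim (x≢x′ (sym (fun-injective g (trans gx′≡x (sym gx)))))
  ...   | inj₂ refl | inj₂ gx′≡x′ = gx′≡x′

  swaps-blue : ∀ {g} → g ∈G → ∀ {p c} → fun g p ≡ p → Blue p c → fun g c ≢ c →
    ∀ {z z′} → Blue p z → Blue p z′ → z ≢ z′ → fun g z ≡ z′
  swaps-blue g∈G gp bc gc≢c {z} {z′} bz bz′ z≢z′ with blue-other bz
  ... | _ , _ , _ , only with only _ (blue-map-fixed g∈G gp bz) | only z′ bz′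
  ...   | inj₁ gz≡z | _ = ⊥-elim (gc≢c (fixes-blue g∈G gp bz gz≡z _ bc))
  ...   | inj₂ _ | inj₁ z′≡z = ⊥-elim (z≢z′ (sym z′≡z))
  ...   | inj₂ gz≡z″ | inj₂ z′≡z″ = trans gz≡z″ (sym z′≡z″)

  red-transport : ∀ {g} → g ∈G → ∀ {q p} → fun g (red q) ≡ red p → fun g q ≡ p
  red-transport {g} g∈G {q} {p} e = begin
    fun g q                ≡⟨ cong (fun g) (sym (red-involutive q)) ⟩
    fun g (red (red q))    ≡⟨ red-equivariant g∈G (red q) ⟩
    red (fun g (red q))    ≡⟨ cong red e ⟩
    red (red p)            ≡⟨ red-involutive p ⟩
    p                      ∎
    where open ≡-Reasoning

  -- Chain i q stands for the alternating path q, red q, b₁, red b₁, …, bᵢ; only the bₖ are stored.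
  Chain : ℕ → V → Set
  Chain zero    q = ⊤
  Chain (suc i) q = Σ V λ b → Blue (red q) b × Chain i b

  Fixes : Aut Γ → ∀ {i q} → Chain i q → Set
  Fixes g {zero}  {q} _           = fun g q ≡ q
  Fixes g {suc i} {q} (_ , _ , C) = fun g q ≡ q × Fixes g C

  fixes-origin : ∀ {g i q} (C : Chain i q) → Fixes g C → fun g q ≡ q
  fixes-origin {i = zero}  _ f       = f
  fixes-origin {i = suc i} _ (f , _) = f

  Maps : Aut Γ → ∀ {i q p} → Chain i q → Chain i p → Set
  Maps h {zero}  {q} {p} _           _           = fun h q ≡ p
  Maps h {suc i} {q} {p} (_ , _ , C) (_ , _ , D) = fun h q ≡ p × Maps h C D

  maps-origin : ∀ {h i q p} (C : Chain i q) (D : Chain i p) → Maps h C D → fun h q ≡ p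
  maps-origin {i = zero}  _ _ m       = m
  maps-origin {i = suc i} _ _ (m , _) = m

  maps-then-fixes : ∀ {σ h i q p} (C : Chain i q) (D : Chain i p) → Maps h C D → Fixes σ D →
    Maps (σ ∘ h) C D
  maps-then-fixes {σ} {i = zero}  _ _ m f = trans (cong (fun σ) m) f
  maps-then-fixes {σ} {i = suc i} (_ , _ , C) (_ , _ , D) (m , ms) (f , fs) =
    trans (cong (fun σ) m) f , maps-then-fixes C D ms fs

  conjugate-fixes : ∀ {h g i q p} (C : Chain i q) (D : Chain i p) → Maps h C D → Fixes g C →
    Fixes (h ∘ (g ∘ (h ⁻¹))) D
  conjugate-fixes {h} {g} {i} {q} {p} C D m f = go i C D m f
    where
      moved : ∀ {x y} → fun h x ≡ y → fun g x ≡ x → fun h (fun g (fun (h ⁻¹) y)) ≡ y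
      moved {x} hx gx = trans (cong (λ z → fun h (fun g z)) (fun⁻¹-≡ h hx)) (trans (cong (fun h) gx) hx)
      go : ∀ i {q p} (C : Chain i q) (D : Chain i p) → Maps h C D → Fixes g C →
        Fixes (h ∘ (g ∘ (h ⁻¹))) D
      go zero    _           _           m        f        = moved m f
      go (suc i) (_ , _ , C) (_ , _ , D) (m , ms) (f , fs) = moved m f , go i C D ms fs

  Rigid : ∀ {i q} → Chain i q → Set
  Rigid {q = q} C = ∀ g → g ∈G → Fixes g C → ∀ c → Blue q c → fun g c ≡ c

  AllRigid : ℕ → Set
  AllRigid i = ∀ q (C : Chain i q) → Rigid C

  Moving : ∀ {i p} → Chain i p → Set
  Moving {p = p} D = Σ (Aut Γ) λ g → g ∈G × Fixes g D × Σ V λ c → Blue p c × fun g c ≢ c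

  Transitive : ∀ {i p} → Chain i p → Set
  Transitive {i} D = ∀ q (C : Chain i q) → Σ (Aut Γ) λ h → h ∈G × Maps h C D

  transitive-zero : ∀ p → Transitive {zero} {p} tt
  transitive-zero p q _ = vt q p

  transitive-extend : ∀ {i p} (D : Chain i p) → Transitive D → Moving D →
    ∀ p′ (bl : Blue (red p′) p) → Transitive {suc i} {p′} (p , bl , D)
  transitive-extend {p = p} D tr (σ , σ∈G , σD , c , bc , σc≢c) p′ bl q (b , bl′ , C) =
    let (h , h∈G , hCD) = tr b C
    in align h∈G hCD (subst (λ x → Blue x _) (maps-origin C D hCD) (blue-map h∈G (blue-sym bl′)))
    where
      align : ∀ {h} → h ∈G → Maps h C D → Blue p (fun h (red q)) →
        Σ (Aut Γ) λ h′ → h′ ∈G × Maps h′ (b , bl′ , C) (p , bl , D)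
      align {h} h∈G hCD hrq with blue-dec hrq (blue-sym bl)
      ... | yes e  = h , h∈G , red-transport h∈G e , hCD
      ... | no hrq≢rp′ = σ ∘ h , σh∈G , red-transport σh∈G σhrq , maps-then-fixes C D hCD σD
        where
          σh∈G : (σ ∘ h) ∈G
          σh∈G = closed∘ G σ∈G h∈G
          σhrq : fun σ (fun h (red q)) ≡ red p′
          σhrq = swaps-blue σ∈G (fixes-origin D σD) bc σc≢c hrq (blue-sym bl) hrq≢rp′

  rigid-of-transitive : ∀ {i p} (D : Chain i p) → Transitive D → ¬ Moving D → AllRigid i
  rigid-of-transitive {p = p} D tr still q C g g∈G gC c bc =
    let (h , h∈G , hCD) = tr q C in settle h∈G hCD
    where
      settle : ∀ {h} → h ∈G → Maps h C D → fun g c ≡ c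
      settle {h} h∈G hCD = decide (blue-dec khc hc)
        where
          k∈G : (h ∘ (g ∘ (h ⁻¹))) ∈G
          k∈G = closed∘ G h∈G (closed∘ G g∈G (closed⁻¹ G h∈G))
          hc : Blue p (fun h c)
          hc = subst (λ x → Blue x (fun h c)) (maps-origin C D hCD) (blue-map h∈G bc)
          khc : Blue p (fun h (fun g (fun (h ⁻¹) (fun h c))))
          khc = blue-map-fixed k∈G (fixes-origin D (conjugate-fixes C D hCD gC)) hc
          decide : Dec (fun h (fun g (fun (h ⁻¹) (fun h c))) ≡ fun h c) → fun g c ≡ c
          decide (yes e) = fun-injective h (trans (cong (λ x → fun h (fun g x)) (sym (left h c))) e)
          decide (no ne) = ⊥-elim (still (_ , k∈G , conjugate-fixes C D hCD gC , fun h c , hc , ne))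

  transitive-or-rigid : ∀ {i q} (C : Chain i q) → ¬ ¬ (Transitive C ⊎ Σ ℕ AllRigid)
  transitive-or-rigid {zero} {q} _ = return (inj₁ (transitive-zero q))
  transitive-or-rigid {suc i} {q} (b , bl , C) = transitive-or-rigid C >>= λ where
    (inj₂ rigid) → return (inj₂ rigid)
    (inj₁ tr) → ¬¬-excluded-middle >>= λ where
      (yes moving) → return (inj₁ (transitive-extend C tr moving q bl))
      (no still) → return (inj₂ (i , rigid-of-transitive C tr still))

  rigid-somewhere : ∀ {i q} (C : Chain i q) → Rigid C → ¬ ¬ Σ ℕ AllRigid
  rigid-somewhere {i} C rigid = transitive-or-rigid C >>= λ where
    (inj₂ allRigid) → return allRigid
    (inj₁ tr) → return (i , rigid-of-transitive C tr
                              λ (g , g∈G , gC , c , bc , gc≢c) → gc≢c (rigid g g∈G gC c bc))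

  module Propagation {g : Aut Γ} (g∈G : g ∈G) where

    FixedChainAt : ℕ → V → Set
    FixedChainAt i p = Σ (Chain i p) (Fixes g)

    shorten : ∀ {i p} → FixedChainAt (suc i) p → FixedChainAt i p
    shorten {zero}  (_ , gp , _) = tt , gp
    shorten {suc i} ((b , bl , C) , gp , gC) =
      let (C′ , gC′) = shorten (C , gC) in (b , bl , C′) , gp , gC′

    across-blue : ∀ j → AllRigid j → ∀ {p c} → FixedChainAt j p → Blue p c →
      FixedChainAt j (red c)
    across-blue zero    rigid {p} {c} (C , gC) bc = tt , red-fixed g∈G (rigid p C g g∈G gC c bc)
    across-blue (suc j) rigid {p} {c} (C , gC) bc =
      let (C′ , gC′) = shorten (C , gC)
      in (p , subst (λ x → Blue x p) (sym (red-involutive c)) (blue-sym bc) , C′) ,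
         red-fixed g∈G (rigid p C g g∈G gC c bc) , gC′

    beyond-blue : ∀ j → AllRigid j → ∀ k {p c} → FixedChainAt j p → Blue p c → FixedChainAt k c
    beyond-blue j rigid zero    {p} {c} (C , gC) bc = tt , rigid p C g g∈G gC c bc
    beyond-blue j rigid (suc k) {p} {c} (C , gC) bc =
      let (d , bd) = some-blue (red c)
          (D , gD) = beyond-blue j rigid k (across-blue j rigid (C , gC) bc) bd
      in (d , bd , D) , rigid p C g g∈G gC c bc , gD

    along-edge : ∀ j → AllRigid j → ∀ {p y} → FixedChainAt j p → Adj p y → FixedChainAt j y
    along-edge j rigid fixed p-y with red-or-blue p-y
    ... | inj₂ by = beyond-blue j rigid j fixed by
    along-edge zero    rigid (_ , gp) _ | inj₁ refl = tt , red-fixed g∈G gp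
    along-edge (suc j) rigid {p} (C , gp , gC) _ | inj₁ refl =
      let (d , bd) = some-blue p
          (D , gD) = beyond-blue (suc j) rigid j (C , gp , gC) bd
      in (d , subst (λ x → Blue x d) (sym (red-involutive p)) bd , D) , red-fixed g∈G gp , gD

    along-walk : ∀ j → AllRigid j → ∀ {p w} → Walk Γ p w → FixedChainAt j p → fun g w ≡ w
    along-walk j rigid here         (C , gC) = fixes-origin C gC
    along-walk j rigid (step p-y W) fixed    = along-walk j rigid W (along-edge j rigid fixed p-y)

  idAut-fixes : ∀ {i q} (C : Chain i q) → Fixes (idAut Γ) C
  idAut-fixes {zero}  _           = refl
  idAut-fixes {suc i} (_ , _ , C) = refl , idAut-fixes C

  record IsSubgroupOfG (H : Aut Γ → Set) : Set where
    field
      ⊆G        : ∀ {x} → H x → x ∈G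
      ∘-closed  : ∀ {x y} → H x → H y → H (x ∘ y)
      ⁻¹-closed : ∀ {x} → H x → H (x ⁻¹)
  open IsSubgroupOfG

  G-isSubgroup : IsSubgroupOfG _∈G
  G-isSubgroup = record { ⊆G = λ x∈G → x∈G ; ∘-closed = closed∘ G ; ⁻¹-closed = closed⁻¹ G }

  stabiliser-isSubgroup : ∀ {H} → IsSubgroupOfG H → ∀ v →
    IsSubgroupOfG (λ x → H x × fun x v ≡ v)
  stabiliser-isSubgroup {H} sub v = record
    { ⊆G        = λ (hx , _) → ⊆G sub hx
    ; ∘-closed  = λ {x} (hx , xv) (hy , yv) → ∘-closed sub hx hy , trans (cong (fun x) yv) xv
    ; ⁻¹-closed = λ {x} (hx , xv) → ⁻¹-closed sub hx , fun⁻¹-≡ x xv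
    }

  FiniteCover : (Aut Γ → Set) → Set
  FiniteCover P = Σ (List (Σ (Aut Γ) P)) λ L →
    ∀ x → P x → Any (λ y → _≈ᴬ_ Γ x (proj₁ y)) L

  finiteCover-⇔ : ∀ {P Q : Aut Γ → Set} → (∀ {x} → P x → Q x) → (∀ {x} → Q x → P x) →
    FiniteCover P → FiniteCover Q
  finiteCover-⇔ P⇒Q Q⇒P (L , covers) =
    map (λ (x , px) → x , P⇒Q px) L , λ x qx → Anyₚ.map⁺ (covers x (Q⇒P qx))

  stabiliser-index₂ : ∀ {H} → IsSubgroupOfG H → ∀ {r b} → (∀ {x} → H x → fun x r ≡ r) →
    Blue r b →    FiniteCover (λ x → H x × fun x b ≡ b) → ¬ ¬ FiniteCover H
  stabiliser-index₂ {H} sub {r} {b} fixes-r rb (L , covers) with blue-other rb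
  ... | b′ , _ , _ , only = ¬¬-excluded-middle {A = Σ (Aut Γ) λ σ → H σ × fun σ b ≡ b′} >>= λ
    { (yes (σ , hσ , σb)) → return (map forget L ++ map (shift σ hσ) L , two-cosets σ hσ σb)
    ; (no none)           → return (map forget L , one-coset none)
    }
    where
      Stab-b : Aut Γ → Set
      Stab-b x = H x × fun x b ≡ b
      forget : Σ (Aut Γ) Stab-b → Σ (Aut Γ) H
      forget (x , hx , _) = x , hx
      shift : ∀ σ → H σ → Σ (Aut Γ) Stab-b → Σ (Aut Γ) H
      shift σ hσ (x , hx , _) = σ ∘ x , ∘-closed sub hσ hx
      image : ∀ {x} → H x → (fun x b ≡ b) ⊎ (fun x b ≡ b′)
      image hx = only _ (blue-map-fixed (⊆G sub hx) (fixes-r hx) rb)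
      one-coset : ¬ (Σ (Aut Γ) λ σ → H σ × fun σ b ≡ b′) →
        ∀ x → H x → Any (λ y → _≈ᴬ_ Γ x (proj₁ y)) (map forget L)
      one-coset none x hx with image hx
      ... | inj₁ xb = Anyₚ.map⁺ (covers x (hx , xb))
      ... | inj₂ xb = ⊥-elim (none (x , hx , xb))
      two-cosets : ∀ σ hσ → fun σ b ≡ b′ →
        ∀ x → H x → Any (λ y → _≈ᴬ_ Γ x (proj₁ y)) (map forget L ++ map (shift σ hσ) L)
      two-cosets σ hσ σb x hx with image hx
      ... | inj₁ xb = Anyₚ.++⁺ˡ (Anyₚ.map⁺ (covers x (hx , xb)))
      ... | inj₂ xb = Anyₚ.++⁺ʳ (map forget L)
        (Anyₚ.map⁺ {P = λ y → _≈ᴬ_ Γ x (proj₁ y)}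
          (Any.map (λ {y} → undo {y}) (covers (σ ⁻¹ ∘ x) σ⁻¹x)))
        where
          σ⁻¹x : Stab-b (σ ⁻¹ ∘ x)
          σ⁻¹x = ∘-closed sub (⁻¹-closed sub hσ) hx , trans (cong (inv σ) xb) (fun⁻¹-≡ σ σb)
          undo : ∀ {y} → _≈ᴬ_ Γ (σ ⁻¹ ∘ x) (proj₁ y) →
            _≈ᴬ_ Γ x (proj₁ (shift σ hσ y))
          undo e v = trans (sym (right σ (fun x v))) (cong (fun σ) (e v))

  stabiliser-peel : ∀ {H} → IsSubgroupOfG H → ∀ {i q} (C : Chain i q) →
    (∀ {x} → H x → fun x q ≡ q) →    FiniteCover (λ x → H x × Fixes x C) → ¬ ¬ FiniteCover H
  stabiliser-peel sub {zero} _ fixes-q cover =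
    return (finiteCover-⇔ proj₁ (λ hx → hx , fixes-q hx) cover)
  stabiliser-peel {H} sub {suc i} {q} (b , bl , C) fixes-q cover =
    stabiliser-peel (stabiliser-isSubgroup sub b) C proj₂ (finiteCover-⇔ regroup ungroup cover)
      >>= stabiliser-index₂ sub (λ hx → red-fixed (⊆G sub hx) (fixes-q hx)) bl
    where
      regroup : ∀ {x} → H x × fun x q ≡ q × Fixes x C → (H x × fun x b ≡ b) × Fixes x C
      regroup (hx , _ , xC) = (hx , fixes-origin C xC) , xC
      ungroup : ∀ {x} → (H x × fun x b ≡ b) × Fixes x C → H x × fun x q ≡ q × Fixes x C
      ungroup ((hx , _) , xC) = hx , fixes-q hx , xC

  some-chain : ∀ i p → Chain i p
  some-chain zero    p = tt
  some-chain (suc i) p = let (b , bl) = some-blue (red p) in b , bl , some-chain i b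

  finiteStab-of-allRigid : Connected Γ → ∀ j → AllRigid j → ∀ p → ¬ ¬ FiniteStab Γ G p
  finiteStab-of-allRigid conn j rigid p =
    stabiliser-peel (stabiliser-isSubgroup G-isSubgroup p) C proj₂ trivial >>= λ (L , covers) →
    return (L , λ (x , px) → covers x px)
    where
      C : Chain j p
      C = some-chain j p
      trivial : FiniteCover (λ x → (x ∈G × fun x p ≡ p) × Fixes x C)
      trivial = ((idAut Γ , (hasId G , refl) , idAut-fixes C) ∷ []) ,
        λ x ((x∈G , _) , xC) → here λ w → Propagation.along-walk x∈G j rigid (conn p w) (C , xC)

  RedAt : (ℕ → V) → ℕ → Set
  RedAt α i = α (suc i) ≡ red (α i)

  AlternatingPath : ℕ → (ℕ → V) → Set
  AlternatingPath s α = (∀ i → i < s → Adj (α i) (α (suc i)))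
                      × (∀ i → suc i < s → ExactlyOne (RedAt α i) (RedAt α (suc i)))

  Returns : ℕ → (ℕ → V) → Set
  Returns s α = (α 0 ≡ α s) ⊎ Adj (α 0) (α s)

  RigidChain : Set
  RigidChain = Σ ℕ λ m → Σ V λ q → Σ (Chain m q) Rigid

  alternatingPath-≤ : ∀ {t s α} → t ≤ s → AlternatingPath s α → AlternatingPath t α
  alternatingPath-≤ t≤s (adj , alt) =
    (λ i i<t → adj i (≤-trans i<t t≤s)) , (λ i i<t → alt i (≤-trans i<t t≤s))

  alternatingPath-tail : ∀ {s α} → AlternatingPath (suc s) α → AlternatingPath s (λ k → α (suc k))
  alternatingPath-tail (adj , alt) =
    (λ i i<s → adj (suc i) (s≤s i<s)) , (λ i i<s → alt (suc i) (s≤s i<s))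

  _◂_ : V → (ℕ → V) → ℕ → V
  (x ◂ α) zero    = x
  (x ◂ α) (suc k) = α k

  alternatingPath-◂ : ∀ {s α x} → Adj x (α 0) → ExactlyOne (α 0 ≡ red x) (RedAt α 0) →
    AlternatingPath s α → AlternatingPath (suc s) (x ◂ α)
  alternatingPath-◂ {s} {α} {x} x-α₀ alt₀ (adj , alt) = adj′ , alt′
    where
      adj′ : ∀ i → i < suc s → Adj ((x ◂ α) i) ((x ◂ α) (suc i))
      adj′ zero    _         = x-α₀
      adj′ (suc i) (s≤s i<s) = adj i i<s
      alt′ : ∀ i → suc i < suc s → ExactlyOne (RedAt (x ◂ α) i) (RedAt (x ◂ α) (suc i))
      alt′ zero    _         = alt₀
      alt′ (suc i) (s≤s i<s) = alt i i<s

  reverse : ℕ → (ℕ → V) → ℕ → V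
  reverse s α k = α (s ∸ k)

  reverse-redAt : ∀ {s α i} → i < s → RedAt (reverse s α) i ⇔ RedAt α (s ∸ suc i)
  reverse-redAt {s} {α} {i} i<s rewrite ∸-suc i<s = mk⇔ red-swap red-swap

  alternatingPath-reverse : ∀ {s α} → AlternatingPath s α → AlternatingPath s (reverse s α)
  alternatingPath-reverse {s} {α} (adj , alt) = adj′ , alt′
    where
      adj′ : ∀ i → i < s → Adj (reverse s α i) (reverse s α (suc i))
      adj′ i i<s rewrite ∸-suc i<s = adj-sym (adj (s ∸ suc i) (∸-suc-< i<s))
      alt′ : ∀ i → suc i < s → ExactlyOne (RedAt (reverse s α) i) (RedAt (reverse s α) (suc i))
      alt′ i i+1<s = exactlyOne-swap (reverse-redAt {α = α} i+1<s) shifted (alt j j+1<s)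
        where
          i<s : i < s
          i<s = ≤-trans (n≤1+n _) i+1<s
          j : ℕ
          j = s ∸ suc (suc i)
          j+1<s : suc j < s
          j+1<s = subst (_< s) (∸-suc i+1<s) (∸-suc-< i<s)
          shifted : RedAt (reverse s α) i ⇔ RedAt α (suc j)
          shifted = subst (λ k → RedAt (reverse s α) i ⇔ RedAt α k) (∸-suc i+1<s)
                      (reverse-redAt {α = α} i<s)

  returns-reverse : ∀ {s α} → Returns s α → Returns s (reverse s α)
  returns-reverse {s} {α} (inj₁ closed) = inj₁ (trans (sym closed) (cong α (sym (n∸n≡0 s))))
  returns-reverse {s} {α} (inj₂ adjacent) =
    inj₂ (subst (λ k → Adj (α s) (α k)) (sym (n∸n≡0 s)) (adj-sym adjacent))

  FixesPrefix : Aut Γ → ℕ → (ℕ → V) → Set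
  FixesPrefix g n γ = ∀ k → k ≤ n → fun g (γ k) ≡ γ k

  Anchored : ℕ → (ℕ → V) → Set
  Anchored n γ = Σ ℕ λ m → Σ (Chain m (γ 0)) λ C →
    ∀ {g} → g ∈G → Fixes g C → FixesPrefix g n γ

  anchored : ∀ n γ → AlternatingPath n γ → (0 < n → RedAt γ 0) → Anchored n γ
  anchored zero γ _ _ = zero , tt , λ _ gγ₀ → λ { zero _ → gγ₀ }
  anchored (suc zero) γ _ red₀ = zero , tt , λ g∈G gγ₀ → λ
    { zero          _           → gγ₀
    ; (suc zero)    _           → red-fixed′ g∈G gγ₀ (red₀ (s≤s z≤n))
    ; (suc (suc k)) (s≤s ())
    }
  anchored (suc (suc n)) γ path@(adj , alt) red₀ =
    let (m , C , fixes) = anchored n (λ k → γ (suc (suc k)))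
                            (alternatingPath-tail (alternatingPath-tail path)) red₂
    in suc m , (γ 2 , blue₂ , C) , λ { g∈G (gγ₀ , gC) → prefix g∈G gγ₀ (fixes g∈G gC) }
    where
      red₁ : γ 1 ≡ red (γ 0)
      red₁ = red₀ (s≤s z≤n)
      not-red₁ : ¬ RedAt γ 1
      not-red₁ = exactlyOne-¬ʳ (alt 0 (s≤s (s≤s z≤n))) red₁
      red₂ : 0 < n → RedAt γ 2
      red₂ 0<n = exactlyOne-ʳ (alt 1 (s≤s (s≤s 0<n))) not-red₁
      blue₂ : Blue (red (γ 0)) (γ 2)
      blue₂ with red-or-blue (adj 1 (s≤s (s≤s z≤n)))
      ... | inj₁ r = ⊥-elim (not-red₁ r)
      ... | inj₂ b = subst (λ x → Blue x (γ 2)) red₁ b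
      prefix : ∀ {g} → g ∈G → fun g (γ 0) ≡ γ 0 → FixesPrefix g n (λ k → γ (suc (suc k))) →
        FixesPrefix g (suc (suc n)) γ
      prefix g∈G gγ₀ _    zero          _               = gγ₀
      prefix g∈G gγ₀ _    (suc zero)    _               = red-fixed′ g∈G gγ₀ red₁
      prefix g∈G gγ₀ rest (suc (suc k)) (s≤s (s≤s k≤n)) = rest k k≤n

  rigidChain-of-fixedBlue : ∀ {n γ u} → Anchored n γ → Blue (γ 0) u →
    (∀ {g} → g ∈G → FixesPrefix g n γ → fun g u ≡ u) → RigidChain
  rigidChain-of-fixedBlue {γ = γ} (m , C , fixes) bu fixes-u =
    m , γ 0 , C , λ g g∈G gC → fixes-blue g∈G (fixes-origin C gC) bu (fixes-u g∈G (fixes g∈G gC))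

  RigidFromReturn : ℕ → Set
  RigidFromReturn s = ∀ α → AlternatingPath s α → 2 ≤ s → Returns s α → RigidChain

  rigidFromReturn-redStart : ∀ {s} → (∀ {t} → t < s → RigidFromReturn t) →
    ∀ α → AlternatingPath s α → 2 ≤ s → RedAt α 0 → Returns s α → RigidChain
  rigidFromReturn-redStart {suc zero} _ _ _ (s≤s ()) _
  rigidFromReturn-redStart {suc (suc t)} ih α path@(adj , alt) 2≤s red₀ = from
    where
      whole : Anchored (suc (suc t)) α
      whole = anchored _ α path (λ _ → red₀)

      closed-tail : ∀ k → 1 ≤ k → suc k ≤ suc (suc t) → α 1 ≡ α (suc k) → RigidChain
      closed-tail (suc zero)    _ _     e = ⊥-elim (irrefl (subst (Adj (α 1)) (sym e) (adj 1 2≤s)))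
      closed-tail (suc (suc k)) _ k<s e =
        ih k<s (λ j → α (suc j)) (alternatingPath-≤ (≤-pred k<s) (alternatingPath-tail path))
          (s≤s (s≤s z≤n)) (inj₁ e)

      closed-red : ∀ k → suc (suc k) ≤ suc (suc t) → α 1 ≡ α (suc k) → RedAt α (suc k) →
        RigidChain
      closed-red zero    _     _ red₁ = ⊥-elim (exactlyOne-¬ʳ (alt 0 2≤s) red₀ red₁)
      closed-red (suc k) k<s e _    = closed-tail (suc k) (s≤s z≤n) (≤-trans (n≤1+n _) k<s) e

      from : Returns (suc (suc t)) α → RigidChain
      from (inj₁ closed) with red-or-blue (adj (suc t) ≤-refl)
      ... | inj₂ blueₗ =
        rigidChain-of-fixedBlue whole (subst (λ x → Blue x (α (suc t))) (sym closed) (blue-sym blueₗ))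
          λ _ fix → fix (suc t) (n≤1+n _)
      ... | inj₁ redₗ =
        closed-red t ≤-refl (trans red₀ (trans (cong red closed) (sym (red-swap redₗ)))) redₗ
      from (inj₂ adjacent) with red-or-blue adjacent
      ... | inj₂ blue = rigidChain-of-fixedBlue whole blue λ _ fix → fix (suc (suc t)) ≤-refl
      ... | inj₁ red = closed-tail (suc t) (s≤s z≤n) ≤-refl (trans red₀ (sym red))

  rigidFromReturn-step : ∀ {s} → (∀ {t} → t < s → RigidFromReturn t) → RigidFromReturn s
  rigidFromReturn-step {suc zero} _ _ _ (s≤s ()) _
  rigidFromReturn-step {suc (suc t)} ih α path@(adj , alt) 2≤s returns
    with red-or-blue (adj 0 (s≤s z≤n)) | red-or-blue (adj (suc t) ≤-refl)
  ... | inj₁ red₀ | _ = rigidFromReturn-redStart ih α path 2≤s red₀ returns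
  ... | inj₂ _ | inj₁ redₗ =
    rigidFromReturn-redStart ih (reverse _ α) (alternatingPath-reverse path) 2≤s (red-swap redₗ)
      (returns-reverse {α = α} returns)
  ... | inj₂ blue₀ | inj₂ blueₗ = from returns
    where
      red₁ : RedAt α 1
      red₁ = exactlyOne-ʳ (alt 0 2≤s) (proj₂ blue₀)
      inner : Anchored (suc t) (λ k → α (suc k))
      inner = anchored _ _ (alternatingPath-tail path) (λ _ → red₁)
      from : Returns (suc (suc t)) α → RigidChain
      from (inj₁ closed) = rigidChain-of-fixedBlue inner (blue-sym blue₀)
        λ {g} _ fix → trans (cong (fun g) closed) (trans (fix (suc t) ≤-refl) (sym closed))
      from (inj₂ adjacent) with red-or-blue (adj-sym adjacent)
      ... | inj₂ blue = rigidChain-of-fixedBlue inner (blue-sym blue₀)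
        λ g∈G fix →
          fixes-blue g∈G (fix (suc t) ≤-refl) (blue-sym blueₗ) (fix t (n≤1+n _)) (α 0) blue
      ... | inj₁ red =
        rigidChain-of-fixedBlue (anchored _ (α (suc (suc t)) ◂ α) cycle λ _ → red) (blue-sym blueₗ)
        λ _ fix → fix (suc (suc t)) (n≤1+n _)
        where
          cycle : AlternatingPath (suc (suc (suc t))) (α (suc (suc t)) ◂ α)
          cycle = alternatingPath-◂ (adj-sym adjacent)
                    (inj₁ red , λ (_ , red₀) → proj₂ blue₀ red₀) path

  rigidFromReturn : ∀ s → RigidFromReturn s
  rigidFromReturn = <-rec RigidFromReturn λ s ih → rigidFromReturn-step ih

module OddEdge (Γ : SimpleGraph) (G : Subgroup Γ) (tri : Trivalent Γ) (vt : VertexTransitive Γ G)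
  {v₀ a b c : SimpleGraph.V Γ} (nbhd : Neighbourhoods.IsNeighbourhood Γ v₀ a b c)
  (a≁b : ¬ SameEdgeOrbit Γ G v₀ a v₀ b) (a≁c : ¬ SameEdgeOrbit Γ G v₀ a v₀ c) where
  open SimpleGraph Γ using (V; Adj) renaming (sym to adj-sym)
  open EdgeOrbits Γ G
  open Neighbourhoods Γ

  carry : V → Aut Γ
  carry u = proj₁ (vt v₀ u)

  carry∈G : ∀ u → _∈G_ G (carry u)
  carry∈G u = proj₁ (proj₂ (vt v₀ u))

  carry-v₀ : ∀ u → fun (carry u) v₀ ≡ u
  carry-v₀ u = proj₂ (proj₂ (vt v₀ u))

  pullback : V → V → V
  pullback u w = fun (carry u ⁻¹) w

  pullback-self : ∀ u → pullback u u ≡ v₀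
  pullback-self u = fun⁻¹-≡ (carry u) (carry-v₀ u)

  pullback-sameOrbit : ∀ {u w x} → pullback u w ≡ x → SameOrbit u w v₀ x
  pullback-sameOrbit {u} refl = carry u ⁻¹ , closed⁻¹ G (carry∈G u) , inj₁ (pullback-self u , refl)

  pullback-adj : ∀ {u w} → Adj u w →
    (pullback u w ≡ a) ⊎ (pullback u w ≡ b) ⊎ (pullback u w ≡ c)
  pullback-adj {u} {w} p =
    neighbourhood-only nbhd _ (subst (λ x → Adj x (pullback u w)) (pullback-self u) (pres (carry u ⁻¹) p))

  pullback-inverse : ∀ u {w x} → pullback u w ≡ x → w ≡ fun (carry u) x
  pullback-inverse u {w} e = trans (sym (right (carry u) w)) (cong (fun (carry u)) e)

  red : V → V
  red u = fun (carry u) a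

  red-sameOrbit : ∀ u → SameOrbit u (red u) v₀ a
  red-sameOrbit u = pullback-sameOrbit (left (carry u) a)

  red-unique : ∀ {u w} → Adj u w → SameOrbit u w v₀ a → w ≡ red u
  red-unique {u} {w} p w~a with pullback-adj p
  ... | inj₁ e = pullback-inverse u e
  ... | inj₂ (inj₁ e) = ⊥-elim (a≁b (sameOrbit-trans (sameOrbit-sym w~a) (pullback-sameOrbit e)))
  ... | inj₂ (inj₂ e) = ⊥-elim (a≁c (sameOrbit-trans (sameOrbit-sym w~a) (pullback-sameOrbit e)))

  red-adj : ∀ u → Adj u (red u)
  red-adj u = subst (λ x → Adj x (red u)) (carry-v₀ u) (pres (carry u) (neighbourhood-adj₁ nbhd))

  matching : RedMatching Γ G
  matching = record
    { red             = red
    ; red-adj         = red-adj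
    ; red-involutive  = λ u → sym (red-unique (adj-sym (red-adj u)) (sameOrbit-swapˡ (red-sameOrbit u)))
    ; red-equivariant = λ {g} g∈G u → red-unique (pres g (red-adj u))
        (sameOrbit-trans (sameOrbit-sym (sameOrbit-image g∈G u (red u))) (red-sameOrbit u))
    }

  open Colouring Γ G tri vt matching

  blue-sameOrbit : SameEdgeOrbit Γ G v₀ b v₀ c → ∀ {u w} → Blue u w → SameOrbit u w v₀ b
  blue-sameOrbit b~c {u} {w} (p , w≢red) with pullback-adj p
  ... | inj₁ e = ⊥-elim (w≢red (pullback-inverse u e))
  ... | inj₂ (inj₁ e) = pullback-sameOrbit e
  ... | inj₂ (inj₂ e) = sameOrbit-trans (pullback-sameOrbit e) (sameOrbit-sym b~c)

  alternatingPath-of-arc : SameEdgeOrbit Γ G v₀ b v₀ c → ∀ {s α} → IsArc Γ G s α →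
    IsAlternating Γ G s α → AlternatingPath s α
  alternatingPath-of-arc b~c {s} {α} (adj , no-backtrack) alternating =
    adj , λ i i+1<s → some-red i i+1<s , not-both i i+1<s
    where
      not-both : ∀ i → suc i < s → ¬ (RedAt α i × RedAt α (suc i))
      not-both i i+1<s (red₀ , red₁) = no-backtrack i i+1<s (trans (red-swap red₀) (sym red₁))
      some-red : ∀ i → suc i < s → RedAt α i ⊎ RedAt α (suc i)
      some-red i i+1<s
        with red-or-blue (adj i (≤-trans (n≤1+n _) i+1<s)) | red-or-blue (adj (suc i) i+1<s)
      ... | inj₁ red₀  | _         = inj₁ red₀
      ... | inj₂ _     | inj₁ red₁ = inj₂ red₁
      ... | inj₂ blue₀ | inj₂ blue₁ =
        ⊥-elim (alternating i i+1<s
          (sameOrbit-trans (blue-sameOrbit b~c blue₀) (sameOrbit-sym (blue-sameOrbit b~c blue₁))))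

  module _ (b≁c : ¬ SameEdgeOrbit Γ G v₀ b v₀ c) where

    neighbours-separated : ∀ {x y} → (x ≡ a) ⊎ (x ≡ b) ⊎ (x ≡ c) →
      (y ≡ a) ⊎ (y ≡ b) ⊎ (y ≡ c) → SameOrbit v₀ x v₀ y → x ≡ y
    neighbours-separated (inj₁ refl)        (inj₁ refl)        _ = refl
    neighbours-separated (inj₁ refl)        (inj₂ (inj₁ refl)) o = ⊥-elim (a≁b o)
    neighbours-separated (inj₁ refl)        (inj₂ (inj₂ refl)) o = ⊥-elim (a≁c o)
    neighbours-separated (inj₂ (inj₁ refl)) (inj₁ refl)        o = ⊥-elim (a≁b (sameOrbit-sym o))
    neighbours-separated (inj₂ (inj₁ refl)) (inj₂ (inj₁ refl)) _ = refl
    neighbours-separated (inj₂ (inj₁ refl)) (inj₂ (inj₂ refl)) o = ⊥-elim (b≁c o)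
    neighbours-separated (inj₂ (inj₂ refl)) (inj₁ refl)        o = ⊥-elim (a≁c (sameOrbit-sym o))
    neighbours-separated (inj₂ (inj₂ refl)) (inj₂ (inj₁ refl)) o = ⊥-elim (b≁c (sameOrbit-sym o))
    neighbours-separated (inj₂ (inj₂ refl)) (inj₂ (inj₂ refl)) _ = refl

    stabiliser-fixes-neighbours : ∀ {g} → _∈G_ G g → ∀ {q w} → fun g q ≡ q → Adj q w →
      fun g w ≡ w
    stabiliser-fixes-neighbours {g} g∈G {q} {w} gq p =
      sym (fun-injective (carry q ⁻¹) (neighbours-separated (pullback-adj p) (pullback-adj gp) same))
      where
        gp : Adj q (fun g w)
        gp = subst (λ x → Adj x (fun g w)) gq (pres g p)
        same : SameOrbit v₀ (pullback q w) v₀ (pullback q (fun g w))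
        same = sameOrbit-trans (sameOrbit-sym (pullback-sameOrbit refl))
                 (sameOrbit-trans (subst (λ x → SameOrbit q w x (fun g w)) gq (sameOrbit-image g∈G q w))
                   (pullback-sameOrbit refl))

    allRigid-zero : AllRigid 0
    allRigid-zero q _ g g∈G gq w (p , _) = stabiliser-fixes-neighbours g∈G gq p

  returning-arc-absurd : Connected Γ → InfiniteStabilizers Γ G →
    Dec (SameEdgeOrbit Γ G v₀ b v₀ c) →
    ∀ {s α} → 2 ≤ s → IsArc Γ G s α → IsAlternating Γ G s α → Returns s α → ⊥
  returning-arc-absurd conn inf b~c? {s} {α} 2≤s arc alternating returns =
    (some-allRigid b~c? >>= λ (j , rigid) → finiteStab-of-allRigid conn j rigid v₀) (inf v₀)
    where
      some-allRigid : Dec (SameEdgeOrbit Γ G v₀ b v₀ c) → ¬ ¬ Σ ℕ AllRigid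
      some-allRigid (yes b~c) =
        let (_ , _ , C , rigid) =
              rigidFromReturn s α (alternatingPath-of-arc b~c arc alternating) 2≤s returns
        in rigid-somewhere C rigid
      some-allRigid (no b≁c) = return (0 , allRigid-zero b≁c)

corollary4p7 : (Γ : SimpleGraph) → (G : Subgroup Γ) →
    Connected Γ → Trivalent Γ →
    VertexTransitive Γ G → ¬ EdgeTransitive Γ G → InfiniteStabilizers Γ G →
    (s : ℕ) → 2 ≤ s → (α : ℕ → SimpleGraph.V Γ) →
    IsArc Γ G s α → IsAlternating Γ G s α →
    (α 0 ≢ α s) × ¬ SimpleGraph.Adj Γ (α 0) (α s)
corollary4p7 Γ G conn tri vt _ inf s 2≤s α arc@(adj , no-backtrack) alternating =
  (λ closed → absurd (inj₁ closed)) , (λ adjacent → absurd (inj₂ adjacent))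
  where
    open SimpleGraph Γ using (V; Adj) renaming (sym to adj-sym)
    open EdgeOrbits Γ G
    open Neighbourhoods Γ

    third : Σ V λ x → IsNeighbourhood (α 1) (α 0) (α 2) x
    third = completeNeighbourhood tri (adj-sym (adj 0 (≤-trans (n≤1+n 1) 2≤s))) (adj 1 2≤s)
              (λ e → no-backtrack 0 2≤s (sym e))

    0≁2 : ¬ SameOrbit (α 1) (α 0) (α 1) (α 2)
    0≁2 o = alternating 0 2≤s (sameOrbit-swapˡ o)

    absurd : (α 0 ≡ α s) ⊎ Adj (α 0) (α s) → ⊥
    -- If x ~ α₀ the edge α₁α₂ is alone in its orbit; otherwise α₁α₀ is.
    absurd returns = let (x , around-α₁) = third in ¬¬-excluded-middle λ where
      (yes x~0) → OddEdge.returning-arc-absurd Γ G tri vt (neighbourhood-swap₁₂ around-α₁)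
        (λ o → 0≁2 (sameOrbit-sym o))
        (λ o → 0≁2 (sameOrbit-trans (sameOrbit-sym x~0) (sameOrbit-sym o)))
        conn inf (yes (sameOrbit-sym x~0)) 2≤s arc alternating returns
      (no x≁0) → ¬¬-excluded-middle λ b~c? → OddEdge.returning-arc-absurd Γ G tri vt around-α₁
        0≁2 (λ o → x≁0 (sameOrbit-sym o)) conn inf b~c? 2≤s arc alternating returns
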